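{- Let $V\subseteq\mathbb{P}$ and $\phi_0\in\mathcal{L}^{ -*}$. If $V\models\phi_0$, then there is no closed tableau for $(V,\phi_0)$.
   Context: $\mathsf{DL\text{ - }PA}$: $\mathbb{P}$ is a countable set of propositional variables; an assignment $\alpha$ is a non-empty finite partial function $\mathbb{P}\to\{\top,\bot\}$ with domain $\mathrm{dom}(\alpha)$. Formulas $\phi ::= p \mid \neg\phi \mid \phi\wedge\phi \mid [\pi]\phi$, programs $\pi ::= \alpha \mid \pi;\pi \mid \pi\cup\pi \mid \pi^* \mid \phi?$; $\mathcal{L}$ is the set of formulas, $\mathcal{L}^{ -*}$ those without ${}^*$. A model is $V\subseteq\mathbb{P}$; $V^\alpha=\{p\in V:p\notin\mathrm{dom}(\alpha)\}\cup\{p\in\mathrm{dom}(\alpha):\alpha(p)=\top\}$. Semantics: $V\models p$ iff $p\in V$; $\neg,\wedge$ classical; $V\models[\pi]\phi$ iff $V'\models\phi$ for all $(V,V')\in R_\pi$, where $R_\alpha=\{(V,V^\alpha)\}$, $R_{\pi_1;\pi_2}=R_{\pi_1}\circ R_{\pi_2}$ (first $\pi_1$ then $\pi_2$), $R_{\pi_1\cup\pi_2}=R_{\pi_1}\cup R_{\pi_2}$, $R_{\pi^*}$ the reflexive–transitive closure of $R_\pi$, $R_{\phi?}=\{(V,V):V\models\phi\}$. $\mathbb{P}_{\phi_0}$ denotes the set of propositional variables occurring in $\phi_0$ (including those in domains of assignments occurring in $\phi_0$). Tableaux: a labelled formula is a pair $\langle\sigma,\phi\rangle$ with $\sigma$ a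 (possibly empty) finite sequence of assignments and $\phi\in\mathcal{L}$; a branch is a set of labelled formulas. The initial branch for $(V,\phi_0)$ is $b_0=\{\langle(),p\rangle:p\in\mathbb{P}_{\phi_0}\cap V\}\cup\{\langle(),\neg p\rangle:p\in\mathbb{P}_{\phi_0}\setminus V\}\cup\{\langle(),\phi_0\rangle\}$. A tableau for $(V,\phi_0)$ is a set of branches that is either $\{b_0\}$ or of the form $(T'\setminus\{b\})\cup\{b\cup b_1,\dots,b\cup b_k\}$ where $T'$ is a tableau for $(V,\phi_0)$, $b\in T'$, and $b_1,\dots,b_k$ are generated by one of the following rules applied to $b$: R$\neg$: $\langle\sigma,\neg\neg\phi\rangle\in b$ gives $k=1$, $b_1=\{\langle\sigma,\phi\rangle\}$. R$\wedge$: $\langle\sigma,\phi\wedge\psi\rangle\in b$ gives $k=1$, $b_1=\{\langle\sigma,\phi\rangle,\langle\sigma,\psi\rangle\}$. R$\vee$: $\langle\sigma,\neg(\phi\wedge\psi)\rangle\in b$ gives $k=2$, $b_1=\{\langle\sigma,\neg\phi\rangle\}$, $b_2=\{\langle\sigma,\neg\psi\rangle\}$. R$[\alpha]$: $\langle\sigma,[\alpha]\phi\rangle\in b$ gives $k=1$, $b_1=\{\langle\sigma\alpha,\phi\rangle\}\cup\{\langle\sigma\alpha,p\rangle:\alpha(p)=\top\}\cup\{\langle\sigma\alpha,\neg p\rangle:\alpha(p)=\bot\}$. R$\langle\alpha\rangle$: $\langle\sigma,\neg[\alpha]\phi\rangle\in b$ gives $k=1$, $b_1=\{\langle\sigma\alpha,\neg\phi\rangle\}\cup\{\langle\sigma\alpha,p\rangle:\alpha(p)=\top\}\cup\{\langle\sigma\alpha,\neg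 p\rangle:\alpha(p)=\bot\}$. R$[?]$: $\langle\sigma,[\psi?]\phi\rangle\in b$ gives $k=2$, $b_1=\{\langle\sigma,\neg\psi\rangle\}$, $b_2=\{\langle\sigma,\phi\rangle\}$. R$\langle?\rangle$: $\langle\sigma,\neg[\psi?]\phi\rangle\in b$ gives $k=1$, $b_1=\{\langle\sigma,\psi\rangle,\langle\sigma,\neg\phi\rangle\}$. R$[;]$: $\langle\sigma,[\pi_1;\pi_2]\phi\rangle\in b$ gives $k=1$, $b_1=\{\langle\sigma,[\pi_1][\pi_2]\phi\rangle\}$. R$\langle;\rangle$: $\langle\sigma,\neg[\pi_1;\pi_2]\phi\rangle\in b$ gives $k=1$, $b_1=\{\langle\sigma,\neg[\pi_1][\pi_2]\phi\rangle\}$. R$[\cup]$: $\langle\sigma,[\pi_1\cup\pi_2]\phi\rangle\in b$ gives $k=1$, $b_1=\{\langle\sigma,[\pi_1]\phi\rangle,\langle\sigma,[\pi_2]\phi\rangle\}$. R$\langle\cup\rangle$: $\langle\sigma,\neg[\pi_1\cup\pi_2]\phi\rangle\in b$ gives $k=2$, $b_1=\{\langle\sigma,\neg[\pi_1]\phi\rangle\}$, $b_2=\{\langle\sigma,\neg[\pi_2]\phi\rangle\}$. RP1: $\langle\sigma,p\rangle,\langle\sigma\alpha,\psi\rangle\in b$ for some $\psi$ with $p\notin\mathrm{dom}(\alpha)$ gives $k=1$, $b_1=\{\langle\sigma\alpha,p\rangle\}$. RP2: $\langle\sigma,\neg p\rangle,\langle\sigma\alpha,\psi\rangle\in b$ for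 some $\psi$ with $p\notin\mathrm{dom}(\alpha)$ gives $k=1$, $b_1=\{\langle\sigma\alpha,\neg p\rangle\}$. A branch is closed iff it is blatantly inconsistent, i.e. contains both $\langle\sigma,\phi\rangle$ and $\langle\sigma,\neg\phi\rangle$ for some $\sigma,\phi$. A tableau is closed iff all its branches are closed. -}

module Defs where

open import Data.Nat using (ℕ; suc; _+_)
open import Data.Bool using (Bool; true; false; if_then_else_)
open import Data.Maybe using (Maybe; just; nothing)
open import Data.Product using (Σ; ∃; _×_; _,_; proj₁)
open import Data.List using (List; []; _∷_; _++_; map; [_]; _∷ʳ_)
open import Data.List.NonEmpty using (List⁺) renaming (toList to toList⁺)
open import Data.List.Membership.Propositional using (_∈_)
open import Data.List.Relation.Unary.All using (All)
open import Relation.Nullary using (¬_)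
open import Relation.Binary.PropositionalEquality using (_≡_; _≗_)
open import Relation.Binary.Construct.Closure.ReflexiveTransitive using (Star)
open import Data.Nat using (_≟_)
open import Relation.Nullary.Decidable using (does)

-- Propositional variables: ℙ = ℕ (a countable set).
--
-- Assignments: non-empty finite partial functions ℕ → {⊤,⊥}.
-- Canonical (gap) encoding, so that equal functions have equal codes:
-- a non-empty list ((g₀,b₀) ∷ (g₁,b₁) ∷ …) encodes the function with
-- domain {k₀ < k₁ < …} where k₀ = g₀ and kᵢ₊₁ = kᵢ + 1 + gᵢ₊₁,
-- and value bᵢ at kᵢ (true = ⊤, false = ⊥).  This is a bijection
-- between List⁺ (ℕ × Bool) and non-empty finite partial functions.

Assign : Set
Assign = List⁺ (ℕ × Bool)

decodeFrom : ℕ → List (ℕ × Bool) → List (ℕ × Bool)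
decodeFrom base [] = []
decodeFrom base ((g , v) ∷ xs) = (base + g , v) ∷ decodeFrom (suc (base + g)) xs

graph : Assign → List (ℕ × Bool)
graph α = decodeFrom 0 (toList⁺ α)

lookupL : List (ℕ × Bool) → ℕ → Maybe Bool
lookupL [] p = nothing
lookupL ((q , v) ∷ xs) p = if does (p ≟ q) then just v else lookupL xs p

app : Assign → ℕ → Maybe Bool
app α = lookupL (graph α)

_∉dom_ : ℕ → Assign → Set
p ∉dom α = app α p ≡ nothing

infix 40 ‵_
infix 35 ~_
infixr 30 _∧'_

mutual
  data Form : Set where
    ‵_    : ℕ → Form
    ~_    : Form → Form
    _∧'_  : Form → Form → Form
    box   : Prog → Form → Form

  data Prog : Set where
    asg   : Assign → Prog
    _⨾_   : Prog → Prog → Prog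
    _∪'_  : Prog → Prog → Prog
    star  : Prog → Prog
    _??   : Form → Prog

mutual
  StarFree : Form → Set
  StarFree (‵ p) = Data.Unit.⊤
    where import Data.Unit
  StarFree (~ φ) = StarFree φ
  StarFree (φ ∧' ψ) = StarFree φ × StarFree ψ
  StarFree (box π φ) = StarFreeP π × StarFree φ

  StarFreeP : Prog → Set
  StarFreeP (asg α) = Data.Unit.⊤
    where import Data.Unit
  StarFreeP (π₁ ⨾ π₂) = StarFreeP π₁ × StarFreeP π₂
  StarFreeP (π₁ ∪' π₂) = StarFreeP π₁ × StarFreeP π₂
  StarFreeP (star π) = Data.Empty.⊥
    where import Data.Empty
  StarFreeP (φ ??) = StarFree φ

mutual
  varsF : Form → List ℕ
  varsF (‵ p) = [ p ]
  varsF (~ φ) = varsF φ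
  varsF (φ ∧' ψ) = varsF φ ++ varsF ψ
  varsF (box π φ) = varsP π ++ varsF φ

  varsP : Prog → List ℕ
  varsP (asg α) = map proj₁ (graph α)
  varsP (π₁ ⨾ π₂) = varsP π₁ ++ varsP π₂
  varsP (π₁ ∪' π₂) = varsP π₁ ++ varsP π₂
  varsP (star π) = varsP π
  varsP (φ ??) = varsF φ

-- Semantics.  A model V ⊆ ℙ is given by its characteristic function.

Model : Set
Model = ℕ → Bool

update : Assign → Model → Model
update α V p with app α p
... | nothing = V p
... | just v  = v

mutual
  infix 20 _⊨_
  _⊨_ : Model → Form → Set
  V ⊨ ‵ p = V p ≡ true
  V ⊨ ~ φ = ¬ (V ⊨ φ)
  V ⊨ φ ∧' ψ = (V ⊨ φ) × (V ⊨ ψ)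
  V ⊨ box π φ = ∀ V' → R π V V' → V' ⊨ φ

  -- R_π (models related up to extensional equality of subsets)
  R : Prog → Model → Model → Set
  R (asg α) V V' = V' ≗ update α V
  R (π₁ ⨾ π₂) V V' = Σ Model (λ W → R π₁ V W × R π₂ W V')
  R (π₁ ∪' π₂) V V' = Data.Sum._⊎_ (R π₁ V V') (R π₂ V V')
    where import Data.Sum
  R (star π) = Star (R π)
  R (φ ??) V V' = (V ⊨ φ) × (V' ≗ V)

-- labels: finite sequences of assignments; σα is  σ ∷ʳ α
Label : Set
Label = List Assign

LForm : Set
LForm = Label × Form

-- a branch (a finite set of labelled formulas, represented by a list;
-- only membership matters)
Branch : Set
Branch = List LForm

effects : Label → Assign → Branch
effects σ α = map (λ pv → (σ , lit pv)) (graph α)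
  where
  lit : ℕ × Bool → Form
  lit (p , true) = ‵ p
  lit (p , false) = ~ (‵ p)

initBranch : Model → Form → Branch
initBranch V φ₀ = map (λ p → ([] , (if V p then ‵ p else ~ (‵ p)))) (varsF φ₀) ++ [ ([] , φ₀) ]

-- Rule b bs : applying a tableau rule to b yields the extensions bs = b₁,…,b_k
data Rule (b : Branch) : List Branch → Set where
  R¬    : ∀ {σ φ} → (σ , ~ ~ φ) ∈ b → Rule b [ [ (σ , φ) ] ]
  R∧    : ∀ {σ φ ψ} → (σ , φ ∧' ψ) ∈ b → Rule b [ (σ , φ) ∷ (σ , ψ) ∷ [] ]
  R∨    : ∀ {σ φ ψ} → (σ , ~ (φ ∧' ψ)) ∈ b →
          Rule b ([ (σ , ~ φ) ] ∷ [ (σ , ~ ψ) ] ∷ [])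
  R[α]  : ∀ {σ α φ} → (σ , box (asg α) φ) ∈ b →
          Rule b [ (σ ∷ʳ α , φ) ∷ effects (σ ∷ʳ α) α ]
  R⟨α⟩  : ∀ {σ α φ} → (σ , ~ box (asg α) φ) ∈ b →
          Rule b [ (σ ∷ʳ α , ~ φ) ∷ effects (σ ∷ʳ α) α ]
  R[?]  : ∀ {σ ψ φ} → (σ , box (ψ ??) φ) ∈ b →
          Rule b ([ (σ , ~ ψ) ] ∷ [ (σ , φ) ] ∷ [])
  R⟨?⟩  : ∀ {σ ψ φ} → (σ , ~ box (ψ ??) φ) ∈ b →
          Rule b [ (σ , ψ) ∷ (σ , ~ φ) ∷ [] ]
  R[⨾]  : ∀ {σ π₁ π₂ φ} → (σ , box (π₁ ⨾ π₂) φ) ∈ b →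
          Rule b [ [ (σ , box π₁ (box π₂ φ)) ] ]
  R⟨⨾⟩  : ∀ {σ π₁ π₂ φ} → (σ , ~ box (π₁ ⨾ π₂) φ) ∈ b →
          Rule b [ [ (σ , ~ box π₁ (box π₂ φ)) ] ]
  R[∪]  : ∀ {σ π₁ π₂ φ} → (σ , box (π₁ ∪' π₂) φ) ∈ b →
          Rule b [ (σ , box π₁ φ) ∷ (σ , box π₂ φ) ∷ [] ]
  R⟨∪⟩  : ∀ {σ π₁ π₂ φ} → (σ , ~ box (π₁ ∪' π₂) φ) ∈ b →
          Rule b ([ (σ , ~ box π₁ φ) ] ∷ [ (σ , ~ box π₂ φ) ] ∷ [])
  RP1   : ∀ {σ α p ψ} → (σ , ‵ p) ∈ b → (σ ∷ʳ α , ψ) ∈ b → p ∉dom α →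
          Rule b [ [ (σ ∷ʳ α , ‵ p) ] ]
  RP2   : ∀ {σ α p ψ} → (σ , ~ (‵ p)) ∈ b → (σ ∷ʳ α , ψ) ∈ b → p ∉dom α →
          Rule b [ [ (σ ∷ʳ α , ~ (‵ p)) ] ]

data IsTableau (V : Model) (φ₀ : Form) : List Branch → Set where
  init : IsTableau V φ₀ [ initBranch V φ₀ ]
  step : ∀ {T₁ T₂ b bs} → IsTableau V φ₀ (T₁ ++ b ∷ T₂) → Rule b bs →
         IsTableau V φ₀ (T₁ ++ map (b ++_) bs ++ T₂)

ClosedBranch : Branch → Set
ClosedBranch b = ∃ λ σ → ∃ λ φ → ((σ , φ) ∈ b) × ((σ , ~ φ) ∈ b)

ClosedTableau : List Branch → Set
ClosedTableau T = All ClosedBranch T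

module Submission where

-- A label σ = α₁ … αₙ denotes the model run σ = (…(V^α₁)…)^αₙ, and a labelled
-- formula ⟨σ , φ⟩ is satisfied when φ is star-free and true in run σ; a branch
-- is satisfied when all its members are.
-- Reading a tableau derivation backwards, unsatisfiability of all branches
-- propagates to the initial branch.  A closed branch is unsatisfiable, so a
-- closed tableau would refute the initial branch, which is impossible.
-- The refutational form avoids any use of excluded middle.

open import Defs
open import Data.Nat using (suc; _+_; _≤_; _≟_)
open import Data.Nat.Properties using (≤-trans; m≤m+n; n≤1+n; >⇒≢)
open import Data.Bool using (true; false; if_then_else_)
open import Data.Maybe using (just; nothing)
open import Data.Product using (_×_; _,_; proj₂)
open import Data.Sum using (inj₁; inj₂)
open import Data.Empty using (⊥-elim)
open import Data.Unit using (tt)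
open import Data.List using (List; []; _∷_; _++_; map; _∷ʳ_; foldl)
open import Data.List.NonEmpty using () renaming (toList to toList⁺)
open import Data.List.Relation.Unary.Any using (here; there)
open import Data.List.Relation.Unary.All using (All; []; _∷_)
import Data.List.Relation.Unary.All as All
open import Data.List.Relation.Unary.All.Properties using (++⁺; ++⁻ˡ; ++⁻ʳ; map⁺; map⁻)
open import Data.List.Membership.Propositional using (_∈_)
open import Data.List.Properties using (foldl-∷ʳ)
open import Function.Bundles using (_⇔_; mk⇔; Equivalence)
open import Relation.Nullary using (¬_)
open import Relation.Nullary.Decidable using (dec-true; dec-false)
open import Relation.Binary.PropositionalEquality
  using (_≡_; _≢_; refl; sym; trans; cong-app; _≗_; subst)

open Equivalence using (to; from)

-- Classically ¬ (A → B) gives A and ¬ B; constructively we keep ¬ ¬ A.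
¬→-split : ∀ {A B : Set} → ¬ (A → B) → ¬ ¬ A × ¬ B
¬→-split n = (λ ¬a → n (λ a → ⊥-elim (¬a a))) , (λ b → n (λ _ → b))

false⇒¬true : ∀ {b} → b ≡ false → ¬ b ≡ true
false⇒¬true refl ()

lookupL-hit : ∀ p v xs → lookupL ((p , v) ∷ xs) p ≡ just v
lookupL-hit p v xs rewrite dec-true (p ≟ p) refl = refl

lookupL-skip : ∀ {p q} v xs → p ≢ q → lookupL ((q , v) ∷ xs) p ≡ lookupL xs p
lookupL-skip {p} {q} v xs p≢q rewrite dec-false (p ≟ q) p≢q = refl

decode-keys-≥ : ∀ c xs {p v} → (p , v) ∈ decodeFrom c xs → c ≤ p
decode-keys-≥ c ((g , w) ∷ xs) (here refl) = m≤m+n c g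
decode-keys-≥ c ((g , w) ∷ xs) (there m) =
  ≤-trans (≤-trans (m≤m+n c g) (n≤1+n _)) (decode-keys-≥ (suc (c + g)) xs m)

-- keys are strictly increasing, so lookup finds the value listed for p
lookup-decode : ∀ c xs {p v} → (p , v) ∈ decodeFrom c xs →
                lookupL (decodeFrom c xs) p ≡ just v
lookup-decode c ((g , w) ∷ xs) (here refl) =
  lookupL-hit (c + g) w (decodeFrom (suc (c + g)) xs)
lookup-decode c ((g , w) ∷ xs) {p} (there m) =
  trans (lookupL-skip w (decodeFrom (suc (c + g)) xs) later-key)
        (lookup-decode (suc (c + g)) xs m)
  where
  -- p is found further down, so it lies strictly above the head key c + g
  later-key : p ≢ c + g
  later-key = >⇒≢ (decode-keys-≥ (suc (c + g)) xs m)

app-graph : ∀ α {p v} → (p , v) ∈ graph α → app α p ≡ just v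
app-graph α = lookup-decode 0 (toList⁺ α)

update-in-dom : ∀ α W {p v} → app α p ≡ just v → update α W p ≡ v
update-in-dom α W {p} e with app α p
update-in-dom α W refl | just v = refl

update-frame : ∀ α W {p} → p ∉dom α → update α W p ≡ W p
update-frame α W {p} e with app α p
update-frame α W refl | nothing = refl

update-≗ : ∀ α {V V′} → V ≗ V′ → update α V ≗ update α V′
update-≗ α e p with app α p
... | nothing = e p
... | just v = refl

-- Truth of star-free formulas (and the relations of star-free programs)
-- only depends on a model up to extensional equality.  This fails for π*,
-- whose reflexive case demands a definitional equality of models.

≗-sym : ∀ {V V′ : Model} → V ≗ V′ → V′ ≗ V
≗-sym e p = sym (e p)

mutual
  ⊨-≗ : ∀ φ → StarFree φ → ∀ {V V′} → V ≗ V′ → V ⊨ φ → V′ ⊨ φ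
  ⊨-≗ (‵ p) _ e h = trans (sym (e p)) h
  ⊨-≗ (~ φ) sf e h h′ = h (⊨-≗ φ sf (≗-sym e) h′)
  ⊨-≗ (φ ∧' ψ) (sφ , sψ) e (hφ , hψ) = ⊨-≗ φ sφ e hφ , ⊨-≗ ψ sψ e hψ
  ⊨-≗ (box π φ) (sπ , _) e h W r = h W (R-≗ π sπ e r)

  R-≗ : ∀ π → StarFreeP π → ∀ {V V′ W} → V ≗ V′ → R π V′ W → R π V W
  R-≗ (asg α) _ e r p = trans (r p) (sym (update-≗ α e p))
  R-≗ (π₁ ⨾ π₂) (s₁ , _) e (X , r₁ , r₂) = X , R-≗ π₁ s₁ e r₁ , r₂
  R-≗ (π₁ ∪' π₂) (s₁ , _) e (inj₁ r) = inj₁ (R-≗ π₁ s₁ e r)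
  R-≗ (π₁ ∪' π₂) (_ , s₂) e (inj₂ r) = inj₂ (R-≗ π₂ s₂ e r)
  R-≗ (star π) () e r
  R-≗ (ψ ??) sψ e (hψ , e′) = ⊨-≗ ψ sψ (≗-sym e) hψ , λ p → trans (e′ p) (sym (e p))

⊨[α] : ∀ α {W φ} → StarFree φ → W ⊨ box (asg α) φ ⇔ update α W ⊨ φ
⊨[α] α {W} {φ} sf =
  mk⇔ (λ h → h (update α W) (λ _ → refl))
      (λ h W′ e → ⊨-≗ φ sf (≗-sym e) h)

⊨[?] : ∀ {W ψ φ} → StarFree φ → W ⊨ box (ψ ??) φ ⇔ (W ⊨ ψ → W ⊨ φ)
⊨[?] {W} {φ = φ} sf =
  mk⇔ (λ h hψ → h W (hψ , λ _ → refl))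
      (λ h W′ (hψ , e) → ⊨-≗ φ sf (≗-sym e) (h hψ))

⊨[⨾] : ∀ {W π₁ π₂ φ} → W ⊨ box (π₁ ⨾ π₂) φ ⇔ W ⊨ box π₁ (box π₂ φ)
⊨[⨾] = mk⇔ (λ h X r₁ W′ r₂ → h W′ (X , r₁ , r₂))
           (λ h W′ (X , r₁ , r₂) → h X r₁ W′ r₂)

⊨[∪] : ∀ {W π₁ π₂ φ} → W ⊨ box (π₁ ∪' π₂) φ ⇔ (W ⊨ box π₁ φ × W ⊨ box π₂ φ)
⊨[∪] = mk⇔ (λ h → (λ W′ r → h W′ (inj₁ r)) , (λ W′ r → h W′ (inj₂ r)))
           (λ { (h₁ , h₂) W′ (inj₁ r) → h₁ W′ r ; (h₁ , h₂) W′ (inj₂ r) → h₂ W′ r })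

module Satisfaction (V : Model) where

  run : Label → Model
  run σ = foldl (λ W α → update α W) V σ

  -- extending a label by α updates its model by α, with the effects on
  -- dom α and the frame elsewhere that the rules R[α], RP1, RP2 record
  run-snoc : ∀ σ α → run (σ ∷ʳ α) ≡ update α (run σ)
  run-snoc σ α = foldl-∷ʳ (λ W α → update α W) V α σ

  run-effect : ∀ σ α {p v} → (p , v) ∈ graph α → run (σ ∷ʳ α) p ≡ v
  run-effect σ α {p} m =
    trans (cong-app (run-snoc σ α) p) (update-in-dom α (run σ) (app-graph α m))

  run-frame : ∀ σ α {p} → p ∉dom α → run (σ ∷ʳ α) p ≡ run σ p
  run-frame σ α {p} nd =
    trans (cong-app (run-snoc σ α) p) (update-frame α (run σ) nd)

  -- star-freeness is carried along since only star-free truth is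
  -- invariant under extensional equality of models
  Good : LForm → Set
  Good (σ , φ) = StarFree φ × run σ ⊨ φ

  Sat : Branch → Set
  Sat = All Good

  effects-sat : ∀ σ α → Sat (effects (σ ∷ʳ α) α)
  effects-sat σ α = map⁺ (All.tabulate literal)
    where
    literal : ∀ {pv} → pv ∈ graph α → Good (σ ∷ʳ α , _)
    literal {p , true} m = tt , run-effect σ α m
    literal {p , false} m = tt , false⇒¬true (run-effect σ α m)

  initial-sat : ∀ {φ₀} → StarFree φ₀ → V ⊨ φ₀ → Sat (initBranch V φ₀)
  initial-sat {φ₀} sf h = ++⁺ (map⁺ (All.universal literal (varsF φ₀))) ((sf , h) ∷ [])
    where
    literal : ∀ p → Good ([] , (if V p then ‵ p else ~ (‵ p)))
    literal p with V p in eq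
    ... | true = tt , eq
    ... | false = tt , false⇒¬true eq

  rule-sound : ∀ {b bs} → Rule b bs → Sat b → ¬ All (λ b′ → ¬ Sat b′) bs
  rule-sound (R¬ m) s (u ∷ []) with All.lookup s m
  ... | sf , ¬¬h = ¬¬h (λ h → u ((sf , h) ∷ []))
  rule-sound (R∧ m) s (u ∷ []) with All.lookup s m
  ... | (sφ , sψ) , (hφ , hψ) = u ((sφ , hφ) ∷ (sψ , hψ) ∷ [])
  rule-sound (R∨ m) s (u₁ ∷ u₂ ∷ []) with All.lookup s m
  ... | (sφ , sψ) , ¬h =
    u₁ ((sφ , λ hφ → u₂ ((sψ , λ hψ → ¬h (hφ , hψ)) ∷ [])) ∷ [])
  rule-sound (R[α] {σ} {α} {φ} m) s (u ∷ []) with All.lookup s m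
  ... | (_ , sf) , h =
    u ((sf , subst (_⊨ φ) (sym (run-snoc σ α)) (to (⊨[α] α sf) h)) ∷ effects-sat σ α)
  rule-sound (R⟨α⟩ {σ} {α} {φ} m) s (u ∷ []) with All.lookup s m
  ... | (_ , sf) , ¬h =
    u ((sf , λ h → ¬h (from (⊨[α] α sf) (subst (_⊨ φ) (run-snoc σ α) h))) ∷ effects-sat σ α)
  rule-sound (R[?] m) s (u₁ ∷ u₂ ∷ []) with All.lookup s m
  ... | (sψ , sφ) , h =
    u₁ ((sψ , λ hψ → u₂ ((sφ , to (⊨[?] sφ) h hψ) ∷ [])) ∷ [])
  rule-sound (R⟨?⟩ m) s (u ∷ []) with All.lookup s m
  ... | (sψ , sφ) , ¬h with ¬→-split (λ f → ¬h (from (⊨[?] sφ) f))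
  ... | ¬¬hψ , ¬hφ = ¬¬hψ (λ hψ → u ((sψ , hψ) ∷ (sφ , ¬hφ) ∷ []))
  rule-sound (R[⨾] m) s (u ∷ []) with All.lookup s m
  ... | ((s₁ , s₂) , sf) , h = u (((s₁ , s₂ , sf) , to ⊨[⨾] h) ∷ [])
  rule-sound (R⟨⨾⟩ m) s (u ∷ []) with All.lookup s m
  ... | ((s₁ , s₂) , sf) , ¬h = u (((s₁ , s₂ , sf) , λ h → ¬h (from ⊨[⨾] h)) ∷ [])
  rule-sound (R[∪] m) s (u ∷ []) with All.lookup s m
  ... | ((s₁ , s₂) , sf) , h with to ⊨[∪] h
  ... | h₁ , h₂ = u (((s₁ , sf) , h₁) ∷ ((s₂ , sf) , h₂) ∷ [])
  rule-sound (R⟨∪⟩ m) s (u₁ ∷ u₂ ∷ []) with All.lookup s m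
  ... | ((s₁ , s₂) , sf) , ¬h =
    u₁ (((s₁ , sf) , λ h₁ → u₂ (((s₂ , sf) , λ h₂ → ¬h (from ⊨[∪] (h₁ , h₂))) ∷ [])) ∷ [])
  rule-sound (RP1 {σ} {α} m _ nd) s (u ∷ []) with All.lookup s m
  ... | _ , h = u ((tt , trans (run-frame σ α nd) h) ∷ [])
  rule-sound (RP2 {σ} {α} m _ nd) s (u ∷ []) with All.lookup s m
  ... | _ , ¬h = u ((tt , λ h → ¬h (trans (sym (run-frame σ α nd)) h)) ∷ [])

  closed-unsat : ∀ {b} → ClosedBranch b → ¬ Sat b
  closed-unsat (σ , φ , m , m′) s = proj₂ (All.lookup s m′) (proj₂ (All.lookup s m))

  unsat-initial : ∀ {φ₀ T} → IsTableau V φ₀ T → All (λ b → ¬ Sat b) T →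
                  ¬ Sat (initBranch V φ₀)
  unsat-initial init (u ∷ []) = u
  unsat-initial (step {T₁} {T₂} {b} {bs} t r) us =
    unsat-initial t (++⁺ (++⁻ˡ T₁ us) (unsat-b ∷ ++⁻ʳ (map (b ++_) bs) rest))
    where
    rest : All (λ b′ → ¬ Sat b′) (map (b ++_) bs ++ T₂)
    rest = ++⁻ʳ T₁ us

    unsat-b : ¬ Sat b
    unsat-b s = rule-sound r s
      (All.map (λ u s′ → u (++⁺ s s′)) (map⁻ (++⁻ˡ (map (b ++_) bs) rest)))

theorem1 : (V : Model) (φ₀ : Form) → StarFree φ₀ → V ⊨ φ₀ →
    (T : List Branch) → IsTableau V φ₀ T → ¬ ClosedTableau T
theorem1 V φ₀ sf h T t closed =
  unsat-initial t (All.map closed-unsat closed) (initial-sat sf h)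
  where open Satisfaction V
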